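{- Let $D=\{e_1,\dots,e_d\}$ and let $P$ be the cyclic permutation $Pe_i=e_{i+1}$ (indices modulo $d$), acting on subsets of $D$. If $S\subseteq D$ has more than one element, then $S$ has a regular antecedent, i.e. there is $e_i\in S$ such that $S\setminus\{e_i\}$ is regular.
   Context: A subset $S\subseteq D$ is regular if its orbit $\{P^kS:k\in\mathbb{Z}\}$ under the cyclic shift $P$ has exactly $d$ members, and special otherwise. For $e_i\in S$, the set $S\setminus\{e_i\}$ is called an antecedent of $S$. -}

module Defs where

open import Data.Nat using (ℕ; zero; suc)
open import Data.Fin using (Fin; zero; suc)
open import Data.Fin.Subset using (Subset; outside)
open import Data.Vec using (Vec; []; _∷_; _∷ʳ_; last; init; updateAt; lookup)
open import Data.List using (List; map; upTo)
open import Data.List.Relation.Unary.Unique.Propositional using (Unique)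

-- D = {e_1,…,e_d} is modelled by Fin d; subsets of D by Subset d (Vec Side d).
-- Cyclic shift P e_i = e_{i+1} (mod d), acting on subsets:
-- i ∈ P S  iff  i-1 ∈ S, i.e. the characteristic vector is rotated right by one.
shift : ∀ {d} → Subset d → Subset d
shift {zero} [] = []
shift {suc d} v = last v ∷ init v

shiftPow : ∀ {d} → ℕ → Subset d → Subset d
shiftPow zero S = S
shiftPow (suc k) S = shift (shiftPow k S)

-- The orbit {P^k S : k ∈ ℤ}, listed as P^0 S, …, P^(d-1) S (P^d = id).
orbitList : ∀ {d} → Subset d → List (Subset d)
orbitList {d} S = map (λ k → shiftPow k S) (upTo d)

-- S is regular iff its orbit has exactly d members, i.e. the d listed
-- shifts are pairwise distinct.
Regular : ∀ {d} → Subset d → Set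
Regular S = Unique (orbitList S)

remove : ∀ {d} → Fin d → Subset d → Subset d
remove i S = updateAt S i (λ _ → outside)

-- Call a maximal run of consecutive non-members of S a gap. As S has two members, every gap is
-- shorter than d − 1. Take a longest gap, of length G, running from the member x to the member
-- e = x + G + 1, and remove e. In T = S ∖ {e} the positions x + 1, …, x + G + 1 are non-members
-- and x is a member. If P^p T = T with 0 < p < d, then either p ≤ G + 1, and x + p is both a member
-- and a non-member of T, or the run x + p + 1, …, x + p + G + 1 of non-members of T lies strictly
-- between e and e + d, so it avoids e and is a gap of S longer than G.
module Submission where

open import Defs
open import Data.Nat using (ℕ; _<_)
open import Data.Product using (∃; _×_)
open import Data.Fin.Subset using (Subset; ∣_∣; _∈_)

open import Data.Bool using (Bool; true; false)
import Data.Bool.Properties as Bool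
open import Data.Empty using (⊥-elim)
open import Data.Fin using (Fin; zero; suc; toℕ; fromℕ; inject₁)
open import Data.Fin.Properties using (toℕ-injective; toℕ-fromℕ<; toℕ-fromℕ; toℕ-inject₁; toℕ<n)
  renaming (suc-injective to Fin-suc-injective)
open import Data.Fin.Subset using (inside; outside)
open import Data.List.Properties using (map-applyUpTo)
open import Data.List.Relation.Unary.Unique.Propositional using (Unique)
open import Data.List.Relation.Unary.Unique.Propositional.Properties using (applyUpTo⁺₁)
open import Data.Nat using (zero; suc; _+_; _*_; _∸_; _≤_; _%_; NonZero; >-nonZero; z<s; s≤s)
open import Data.Nat.DivMod
  using (_mod_; _/_; m≡m%n+[m/n]*n; m%n<n; [m+n]%n≡m%n; m<n⇒m%n≡m; %-pred-≡0; m<[1+n%d]⇒m≤[n%d]; [1+m%d]≤1+n⇒[m%d]≤n)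
open import Data.Nat.Divisibility using (_∣_; divides; ∣m+n∣m⇒∣n; n∣m*n; ∣⇒≤)
open import Data.Nat.Properties
open import Algebra.Properties.CommutativeSemigroup +-commutativeSemigroup using (xy∙z≈xz∙y; x∙yz≈xz∙y)
open import Data.Product using (_,_; ∃₂)
open import Data.Sum using (inj₁; inj₂)
open import Data.Vec using (Vec; []; _∷_; lookup; last; init; here; there)
open import Data.Vec.Properties using (lookup∘updateAt; lookup∘updateAt′; lookup⇒[]=; []=⇒lookup)
open import Function using (_∘_)
open import Relation.Binary.Definitions using (tri<; tri≈; tri>)
open import Relation.Binary.PropositionalEquality
open import Relation.Nullary using (¬_; yes; no; contradiction)
open import Relation.Unary using (Pred; Decidable)

crossing-point : ∀ {p} {P : Pred ℕ p} → Decidable P → P 0 →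
                 ∀ {N} → ¬ P N → ∃ λ G → G < N × P G × ¬ P (suc G)
crossing-point P? P0 {zero} ¬P0 = ⊥-elim (¬P0 P0)
crossing-point P? P0 {suc N} ¬PN with P? N
... | yes PN = N , n<1+n N , PN , ¬PN
... | no ¬PN′ with crossing-point P? P0 ¬PN′
...   | G , G<N , PG , ¬PG′ = G , m<n⇒m<1+n G<N , PG , ¬PG′

[m+n]%o≡m%o⇒o∣n : ∀ m n o .{{_ : NonZero o}} → (m + n) % o ≡ m % o → o ∣ n
[m+n]%o≡m%o⇒o∣n m n o eq = ∣m+n∣m⇒∣n (divides ((m + n) / o) q₀o+n≡q₁o) (n∣m*n (m / o))
  where
  open ≡-Reasoning
  q₀o+n≡q₁o : m / o * o + n ≡ (m + n) / o * o
  q₀o+n≡q₁o = +-cancelˡ-≡ (m % o) _ _ (begin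
    m % o + (m / o * o + n)       ≡⟨ +-assoc (m % o) _ n ⟨
    m % o + m / o * o + n         ≡⟨ cong (_+ n) (m≡m%n+[m/n]*n m o) ⟨
    m + n                         ≡⟨ m≡m%n+[m/n]*n (m + n) o ⟩
    (m + n) % o + (m + n) / o * o ≡⟨ cong (_+ (m + n) / o * o) eq ⟩
    m % o + (m + n) / o * o       ∎)

m<n<m+o⇒n%o≢m%o : ∀ {m n o} .{{_ : NonZero o}} → m < n → n < m + o → n % o ≢ m % o
m<n<m+o⇒n%o≢m%o {m} {n} {o} m<n n<m+o eq = <⇒≱ (m<n+o⇒m∸n<o n m n<m+o) (∣⇒≤ {{>-nonZero 0<r}} o∣r)
  where
  0<r : 0 < n ∸ m
  0<r = m<n⇒0<n∸m m<n
  o∣r : o ∣ n ∸ m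
  o∣r = [m+n]%o≡m%o⇒o∣n m (n ∸ m) o (trans (cong (_% o) (m+[n∸m]≡n (<⇒≤ m<n))) eq)

[1+m]%n≡1+o⇒m%n≡o : ∀ m o n .{{_ : NonZero n}} → suc m % n ≡ suc o → m % n ≡ o
[1+m]%n≡1+o⇒m%n≡o m o n eq = ≤-antisym
  ([1+m%d]≤1+n⇒[m%d]≤n m o n (subst (0 <_) (sym eq) z<s) (≤-reflexive eq))
  (m<[1+n%d]⇒m≤[n%d] m n (≤-reflexive (sym eq)))

HasPeriod : ℕ → (ℕ → Bool) → Set
HasPeriod p g = ∀ k → g (k + p) ≡ g k

-- The positions j + 1, …, j + L; j itself is not part of the gap.
Gap : (ℕ → Bool) → ℕ → ℕ → Set
Gap g j L = ∀ {t} → t < L → g (j + suc t) ≡ false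

module _ {g : ℕ → Bool} where

  period-multiple : ∀ {p} → HasPeriod p g → ∀ q k → g (k + q * p) ≡ g k
  period-multiple {p} period zero k = cong g (+-identityʳ k)
  period-multiple {p} period (suc q) k = begin
    g (k + (p + q * p)) ≡⟨ cong g (x∙yz≈xz∙y k p (q * p)) ⟩
    g (k + q * p + p)   ≡⟨ period (k + q * p) ⟩
    g (k + q * p)       ≡⟨ period-multiple period q k ⟩
    g k                 ∎
    where open ≡-Reasoning

  gap-mod : ∀ {n} .{{_ : NonZero n}} → HasPeriod n g → ∀ {j L} → Gap g j L → Gap g (j % n) L
  gap-mod {n} period {j} gap {t} t<L = begin
    g (j % n + suc t)             ≡⟨ period-multiple period (j / n) _ ⟨
    g (j % n + suc t + j / n * n) ≡⟨ cong g (xy∙z≈xz∙y (j % n) (suc t) _) ⟩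
    g (j % n + j / n * n + suc t) ≡⟨ cong (λ k → g (k + suc t)) (m≡m%n+[m/n]*n j n) ⟨
    g (j + suc t)                 ≡⟨ gap t<L ⟩
    false                         ∎
    where open ≡-Reasoning

  gap-contains : ∀ {j L k} → Gap g j L → j < k → k ≤ j + L → g k ≡ false
  gap-contains {j} {L} {k} gap j<k k≤j+L with m≤n⇒∃[o]m+o≡n j<k
  ... | t , refl = subst (λ i → g i ≡ false) (+-suc j t)
                     (gap (+-cancelˡ-≤ j (suc t) L (subst (_≤ j + L) (sym (+-suc j t)) k≤j+L)))

  gap-extendʳ : ∀ {j L} → Gap g j L → g (j + suc L) ≡ false → Gap g j (suc L)
  gap-extendʳ gap next∉ t<1+L with m<1+n⇒m<n∨m≡n t<1+L
  ... | inj₁ t<L  = gap t<L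
  ... | inj₂ refl = next∉

  module _ {m : ℕ} (period : HasPeriod (suc m) g) where

    gap-extendˡ : ∀ {j L} → Gap g j L → g j ≡ false → Gap g (j + m) (suc L)
    gap-extendˡ {j} {L} gap j∉ {t} t<1+L =
      trans (cong g j+m+1+t≡j+t+n) (trans (period (j + t)) (j-and-gap t t<1+L))
      where
      j+m+1+t≡j+t+n : j + m + suc t ≡ j + t + suc m
      j+m+1+t≡j+t+n = trans (+-assoc j m (suc t))
        (trans (cong (j +_) (trans (+-suc m t) (+-comm (suc m) t))) (sym (+-assoc j t (suc m))))
      j-and-gap : ∀ t → t < suc L → g (j + t) ≡ false
      j-and-gap zero    _         = trans (cong g (+-identityʳ j)) j∉
      j-and-gap (suc t) (s≤s t<L) = gap t<L

    member-blocks-gap : ∀ {w j} → w < suc m → j < suc m → w ≢ j → g w ≡ true → ¬ Gap g j m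
    member-blocks-gap {w} {j} w<n j<n w≢j w∈ gap with <-cmp j w
    ... | tri< j<w _ _ = contradiction (trans (sym w∈) (gap-contains gap j<w w≤j+m)) λ ()
      where
      w≤j+m : w ≤ j + m
      w≤j+m = ≤-trans (<⇒≤pred w<n) (m≤n+m m j)
    ... | tri≈ _ j≡w _ = w≢j (sym j≡w)
    ... | tri> _ _ w<j =
      contradiction (trans (sym w∈) (trans (sym (period w)) (gap-contains gap j<w+n w+n≤j+m))) λ ()
      where
      j<w+n : j < w + suc m
      j<w+n = <-≤-trans j<n (m≤n+m (suc m) w)
      w+n≤j+m : w + suc m ≤ j + m
      w+n≤j+m = subst (_≤ j + m) (sym (+-suc w m)) (+-monoˡ-≤ m w<j)

record LongestGap (n : ℕ) (g : ℕ → Bool) : Set where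
  field
    left    : ℕ
    size    : ℕ
    size<n  : suc size < n
    gap     : Gap g left size
    longest : ∀ j → ¬ Gap g j (suc size)

  right : ℕ
  right = left + suc size

module _ {m : ℕ} {g : ℕ → Bool} (period : HasPeriod (suc m) g) where

  longestGap : ∀ {u v} → u < suc m → v < suc m → u ≢ v → g u ≡ true → g v ≡ true →
               LongestGap (suc m) g
  longestGap {u} {v} u<n v<n u≢v u∈ v∈ with crossing-point gap? (0 , z<s , λ ()) no-full-gap
    where
    HasGap : ℕ → Set
    HasGap L = ∃ λ j → j < suc m × Gap g j L
    gap? : Decidable HasGap
    gap? L = anyUpTo? (λ j → allUpTo? (λ t → g (j + suc t) Bool.≟ false) L) (suc m)
    no-full-gap : ¬ HasGap m
    no-full-gap (j , j<n , gap) with u ≟ j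
    ... | yes refl = member-blocks-gap period v<n j<n (u≢v ∘ sym) v∈ gap
    ... | no u≢j   = member-blocks-gap period u<n j<n u≢j u∈ gap
  ... | G , G<m , (x , _ , gap) , ¬gap = record
    { left    = x
    ; size    = G
    ; size<n  = s≤s G<m
    ; gap     = gap
    ; longest = λ j gap′ → ¬gap (j % suc m , m%n<n j (suc m) , gap-mod period gap′)
    }

  module _ (L : LongestGap (suc m) g) where
    open LongestGap L

    left-member : g left ≡ true
    left-member with g left in eq
    ... | true  = refl
    ... | false = ⊥-elim (longest (left + m) (gap-extendˡ period gap eq))

    right-member : g right ≡ true
    right-member with g right in eq
    ... | true  = refl
    ... | false = ⊥-elim (longest left (gap-extendʳ {g} gap eq))

    module _ {h : ℕ → Bool} (h-period : HasPeriod (suc m) h) (right∉ : h right ≡ false)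
             (agree : ∀ k → right < k → k < right + suc m → h k ≡ g k) where

      private
        agree-before : ∀ k → right < k + suc m → k < right → h k ≡ g k
        agree-before k lo hi =
          trans (sym (h-period k)) (trans (agree (k + suc m) lo (+-monoˡ-< (suc m) hi)) (period k))

        h-left : h left ≡ true
        h-left = trans (agree-before left (+-monoʳ-< left size<n) (m<m+n left z<s)) left-member

        h-gap : Gap h left (suc size)
        h-gap {t} t<1+size with m<1+n⇒m<n∨m≡n t<1+size
        ... | inj₂ refl   = right∉
        ... | inj₁ t<size = trans (agree-before _ lo (+-monoʳ-< left (s≤s t<size))) (gap t<size)
          where
          lo : right < left + suc t + suc m
          lo = <-≤-trans (+-monoʳ-< left size<n) (+-monoˡ-≤ (suc m) (m≤m+n left (suc t)))

      removal-aperiodic : ∀ {p} → 0 < p → p < suc m → ¬ HasPeriod p h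
      removal-aperiodic {suc q} _ p<n p-period with suc q ≤? suc size
      ... | yes p≤1+size =
            contradiction (trans (sym h-left) (trans (sym (p-period left)) (h-gap p≤1+size))) λ ()
      ... | no p≰1+size = longest (left + suc q) λ {t} t<1+size →
            trans (sym (agree _ (lower t) (upper t<1+size)))
              (trans (cong h (xy∙z≈xz∙y left (suc q) (suc t))) (trans (p-period _) (h-gap t<1+size)))
        where
        lower : ∀ t → right < left + suc q + suc t
        lower t = <-≤-trans (+-monoʳ-< left (≰⇒> p≰1+size)) (m≤m+n (left + suc q) (suc t))
        upper : ∀ {t} → t < suc size → left + suc q + suc t < right + suc m
        upper {t} t<1+size = begin-strict
          left + suc q + suc t    ≤⟨ +-monoʳ-≤ (left + suc q) t<1+size ⟩
          left + suc q + suc size <⟨ +-monoˡ-< (suc size) (+-monoʳ-< left p<n) ⟩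
          left + suc m + suc size ≡⟨ xy∙z≈xz∙y left (suc m) (suc size) ⟩
          right + suc m           ∎
          where open ≤-Reasoning

lookup-last : ∀ {a} {A : Set a} {k} (v : Vec A (suc k)) → lookup v (fromℕ k) ≡ last v
lookup-last (x ∷ [])    = refl
lookup-last (x ∷ y ∷ v) = lookup-last (y ∷ v)

lookup-init : ∀ {a} {A : Set a} {k} (v : Vec A (suc k)) i → lookup (init v) i ≡ lookup v (inject₁ i)
lookup-init (x ∷ y ∷ v) zero    = refl
lookup-init (x ∷ y ∷ v) (suc i) = lookup-init (y ∷ v) i

unroll : ∀ {m} → Subset (suc m) → ℕ → Bool
unroll {m} V k = lookup V (k mod suc m)

module _ {m : ℕ} where

  private
    n : ℕ
    n = suc m

  toℕ-mod : ∀ k → toℕ (k mod n) ≡ k % n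
  toℕ-mod k = toℕ-fromℕ< (m%n<n k n)

  unroll-cong : ∀ (V : Subset n) {k l} → k % n ≡ l % n → unroll V k ≡ unroll V l
  unroll-cong V {k} {l} eq =
    cong (lookup V) (toℕ-injective (trans (toℕ-mod k) (trans eq (sym (toℕ-mod l)))))

  unroll-periodic : ∀ (V : Subset n) → HasPeriod n (unroll V)
  unroll-periodic V k = unroll-cong V {k + n} {k} ([m+n]%n≡m%n k n)

  unroll-toℕ : ∀ (V : Subset n) i → unroll V (toℕ i) ≡ lookup V i
  unroll-toℕ V i = cong (lookup V) (toℕ-injective (trans (toℕ-mod (toℕ i)) (m<n⇒m%n≡m (toℕ<n i))))

  unroll-shift : ∀ (V : Subset n) k → unroll (shift V) (suc k) ≡ unroll V k
  unroll-shift V k = lookup-shift (suc k mod n) (toℕ-mod (suc k))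
    where
    lookup-shift : ∀ i → toℕ i ≡ suc k % n → lookup (shift V) i ≡ lookup V (k mod n)
    lookup-shift zero    eq = trans (sym (lookup-last V)) (cong (lookup V) (toℕ-injective
      (trans (toℕ-fromℕ m) (sym (trans (toℕ-mod k) (%-pred-≡0 (sym eq)))))))
    lookup-shift (suc i) eq = trans (lookup-init V i) (cong (lookup V) (toℕ-injective
      (trans (toℕ-inject₁ i) (sym (trans (toℕ-mod k) ([1+m]%n≡1+o⇒m%n≡o k (toℕ i) n (sym eq)))))))

  unroll-shiftPow : ∀ j (V : Subset n) k → unroll (shiftPow j V) (j + k) ≡ unroll V k
  unroll-shiftPow zero    V k = refl
  unroll-shiftPow (suc j) V k = trans (unroll-shift (shiftPow j V) (j + k)) (unroll-shiftPow j V k)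

  shiftPow-collision⇒period : ∀ (V : Subset n) {a b} → a < b → shiftPow a V ≡ shiftPow b V →
                              HasPeriod (b ∸ a) (unroll V)
  shiftPow-collision⇒period V {a} {b} a<b eq k = begin
    unroll V (k + (b ∸ a))                    ≡⟨ unroll-shiftPow a V _ ⟨
    unroll (shiftPow a V) (a + (k + (b ∸ a))) ≡⟨ cong₂ unroll eq (x∙yz≈xz∙y a k (b ∸ a)) ⟩
    unroll (shiftPow b V) (a + (b ∸ a) + k)   ≡⟨ cong (λ i → unroll (shiftPow b V) (i + k)) (m+[n∸m]≡n (<⇒≤ a<b)) ⟩
    unroll (shiftPow b V) (b + k)             ≡⟨ unroll-shiftPow b V k ⟩
    unroll V k                                ∎
    where open ≡-Reasoning

  aperiodic⇒regular : ∀ (V : Subset n) → (∀ {p} → 0 < p → p < n → ¬ HasPeriod p (unroll V)) →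
                      Regular V
  aperiodic⇒regular V aperiodic =
    subst Unique (sym (map-applyUpTo (λ k → k) (λ k → shiftPow k V) n))
      (applyUpTo⁺₁ (λ k → shiftPow k V) n λ {a} {b} a<b b<n eq →
        aperiodic (m<n⇒0<n∸m a<b) (≤-<-trans (m∸n≤m b a) b<n) (shiftPow-collision⇒period V a<b eq))

  unroll-remove-self : ∀ (V : Subset n) k → unroll (remove (k mod n) V) k ≡ false
  unroll-remove-self V k = lookup∘updateAt (k mod n) V

  unroll-remove-other : ∀ (V : Subset n) {k l} → k % n ≢ l % n →
                        unroll (remove (l mod n) V) k ≡ unroll V k
  unroll-remove-other V {k} {l} k≢l = lookup∘updateAt′ (k mod n) (l mod n)
    (λ eq → k≢l (trans (sym (toℕ-mod k)) (trans (cong toℕ eq) (toℕ-mod l)))) V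

nonempty : ∀ {k} (p : Subset k) → 0 < ∣ p ∣ → ∃ λ i → i ∈ p
nonempty (inside ∷ p) _ = zero , here
nonempty (outside ∷ p) 0<∣p∣ with nonempty p 0<∣p∣
... | i , i∈p = suc i , there i∈p

two-members : ∀ {k} (p : Subset k) → 1 < ∣ p ∣ → ∃₂ λ i j → i ≢ j × i ∈ p × j ∈ p
two-members (inside ∷ p) (s≤s 0<∣p∣) with nonempty p 0<∣p∣
... | j , j∈p = zero , suc j , (λ ()) , here , there j∈p
two-members (outside ∷ p) 1<∣p∣ with two-members p 1<∣p∣
... | i , j , i≢j , i∈p , j∈p = suc i , suc j , i≢j ∘ Fin-suc-injective , there i∈p , there j∈p

lemma7p10 : (d : ℕ) (S : Subset d) → 1 < ∣ S ∣ →
    ∃ λ i → i ∈ S × Regular (remove i S)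
lemma7p10 zero [] ()
lemma7p10 (suc m) S 1<∣S∣ with two-members S 1<∣S∣
... | i , j , i≢j , i∈S , j∈S =
  e , lookup⇒[]= e S (right-member S-periodic gap) ,
  aperiodic⇒regular T (removal-aperiodic S-periodic gap (unroll-periodic T) (unroll-remove-self S right) agree)
  where
  S-periodic : HasPeriod (suc m) (unroll S)
  S-periodic = unroll-periodic S
  member : ∀ {k} → k ∈ S → unroll S (toℕ k) ≡ true
  member {k} k∈S = trans (unroll-toℕ S k) ([]=⇒lookup k∈S)
  gap : LongestGap (suc m) (unroll S)
  gap = longestGap S-periodic (toℕ<n i) (toℕ<n j) (i≢j ∘ toℕ-injective) (member i∈S) (member j∈S)
  open LongestGap gap using (right)
  e : Fin (suc m)
  e = right mod suc m
  T : Subset (suc m)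
  T = remove e S
  agree : ∀ k → right < k → k < right + suc m → unroll T k ≡ unroll S k
  agree k lo hi = unroll-remove-other S {k} {right} (m<n<m+o⇒n%o≢m%o lo hi)
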